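{- For every integer $n\ge 3$ there exists a rich word $w$ with $|\mathrm{Alph}(w)|=n$ which cannot be eventually extended richly in $n$ ways; i.e., there is no finite word $u$ over $\mathrm{Alph}(w)$ such that $wu$ is rich and $wua$ is rich for every letter $a\in\mathrm{Alph}(w)$.
   Context: A palindrome is a word equal to its reversal (the empty word is a palindrome). A finite word $w$ is rich if it has exactly $|w|+1$ distinct palindromic factors (counting the empty word). $\mathrm{Alph}(w)$ is the set of letters occurring in $w$. A rich word $x$ can be extended richly in $n$ ways if there exist $n$ distinct letters $a\in\mathrm{Alph}(x)$ with $xa$ rich; a rich word $w$ can be eventually extended richly in $n$ ways if there exists a finite word $u$ such that $wu$ is rich and can be extended richly in $n$ ways. -}

module Defs where

open import Data.Nat using (ℕ; suc)
open import Data.List using (List; []; _∷_; _++_; reverse; length)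
open import Data.List.Membership.Propositional using (_∈_)
open import Data.List.Relation.Unary.Unique.Propositional using (Unique)
open import Data.Product using (Σ; ∃; _×_)
open import Relation.Binary.PropositionalEquality using (_≡_)
open import Function.Bundles using (_⇔_)

Word : Set
Word = List ℕ

Palindrome : Word → Set
Palindrome u = reverse u ≡ u

Factor : Word → Word → Set
Factor u w = ∃ λ p → ∃ λ s → p ++ u ++ s ≡ w

-- w is rich: the set of its palindromic factors (empty word included)
-- has exactly |w| + 1 elements, i.e. it is enumerated without repetition
-- by a list of length |w| + 1.
Rich : Word → Set
Rich w = Σ (List Word) λ L →
  Unique L × (∀ u → (u ∈ L) ⇔ (Factor u w × Palindrome u)) × (length L ≡ suc (length w))

AlphSize : Word → ℕ → Set
AlphSize w n = Σ (List ℕ) λ A →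
  Unique A × (∀ a → (a ∈ A) ⇔ (a ∈ w)) × (length A ≡ n)

-- Let F be a reverse-closed set of words, none occurring in w, such that every palindromic
-- suffix of a word of F over Alph w occurs in w. Then no word of F occurs in a rich extension
-- w u with u over Alph w. Indeed, take an occurrence of π ∈ F ending a shortest possible
-- prefix P of w u; it lies beyond w. In a rich word every prefix has a palindromic suffix f
-- not occurring earlier (otherwise the word would have too few palindromic factors). As the
-- palindromic suffixes of π occur in w, f is longer than π, so f = c π is a palindrome and
-- reverse π, which lies in F, ends a proper prefix of P: an earlier occurrence.
--
-- For n ≥ 4 take w = 0 1 … n-1 and for F the words i j with |i - j| ≥ 2: whatever the last
-- letter of w u, some letter of w completes such a word. For n = 3 a finite check does the
-- same with w = 00101102, eight words in F, and the last three letters of w u.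
module Submission where

open import Data.Nat using (ℕ; zero; suc; _+_; _∸_; _≤_; _<_; z≤n; s≤s; z<s; _≤?_; _≟_)
import Data.Nat.Properties as ℕ
open import Data.List
  using (List; []; _∷_; [_]; _++_; _∷ʳ_; reverse; length; map; take; drop; tails; inits; upTo;
         applyUpTo; initLast; _∷ʳ′_)
open import Data.List.Properties
  using (++-assoc; ++-identityʳ; length-++; length-++-≤ˡ; length-++-≤ʳ; length-map; length-reverse;
         length-removeAt′; length-drop; length-upTo; take++drop≡id; reverse-++; unfold-reverse;
         ∷-injectiveˡ; ∷-injectiveʳ; ∷-injective; ∷ʳ-injectiveˡ; ∷ʳ-++; ≡-dec)
open import Data.List.Membership.Propositional using (_∈_; _─_; find; lose)
open import Data.List.Membership.Propositional.Properties
  using (∈-++⁺ˡ; ∈-++⁺ʳ; ∈-++⁻; ∈-map⁺; ∈-map⁻; ∈-upTo⁺)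
import Data.List.Membership.DecPropositional as DecMembership
open import Data.List.Relation.Binary.Subset.Propositional using (_⊆_)
open import Data.List.Relation.Unary.All as All using (All; []; _∷_; all?)
import Data.List.Relation.Unary.All.Properties as AllProp
open import Data.List.Relation.Unary.Any using (Any; here; there; index; any?)
open import Data.List.Relation.Unary.AllPairs using ([]; _∷_; allPairs?)
open import Data.List.Relation.Unary.Unique.Propositional using (Unique)
import Data.List.Relation.Unary.Unique.Propositional.Properties as Unique
open import Data.Product using (∃; _×_; _,_; proj₂)
open import Data.Sum using (_⊎_; inj₁; inj₂; swap)
open import Data.Empty using (⊥; ⊥-elim)
open import Data.Unit using (tt)
open import Function.Base using (id)
open import Function.Bundles using (Equivalence; mk⇔)
open import Relation.Nullary using (¬_; Dec; yes; no)
open import Relation.Nullary.Decidable using (_×-dec_; _→-dec_; ¬?; toWitness)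
open import Relation.Binary.Definitions using (tri<; tri≈; tri>)
open import Relation.Binary.PropositionalEquality
  using (_≡_; _≢_; refl; sym; trans; cong; subst; module ≡-Reasoning)
open import Defs

Suffix : Word → Word → Set
Suffix s w = ∃ λ t → t ++ s ≡ w

Prefix : Word → Word → Set
Prefix p w = ∃ λ s → p ++ s ≡ w

EventuallyFullyExtendable : Word → Set
EventuallyFullyExtendable w =
  ∃ λ u → All (_∈ w) u × Rich (w ++ u) × (∀ a → a ∈ w → Rich (w ++ (u ∷ʳ a)))

length-∷ʳ : ∀ (v : Word) x → length (v ∷ʳ x) ≡ suc (length v)
length-∷ʳ v x = trans (length-++ v) (ℕ.+-comm (length v) 1)

nonempty-reverse : ∀ x (c : Word) → 0 < length (reverse (x ∷ c))
nonempty-reverse x c = subst (0 <_) (sym (length-reverse (x ∷ c))) z<s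

proper-prefix-shorter : ∀ {A B P : Word} → A ++ B ≡ P → 0 < length B → length A < length P
proper-prefix-shorter {A} e 0<B =
  subst (length A <_) (trans (sym (length-++ A)) (cong length e)) (ℕ.m<m+n (length A) 0<B)

++-split : ∀ (A B C D : Word) → A ++ B ≡ C ++ D → length A ≤ length C →
           ∃ λ E → C ≡ A ++ E × B ≡ E ++ D
++-split []      B C       D e _ = C , refl , e
++-split (a ∷ A) B (c ∷ C) D e (s≤s A≤C) with ∷-injective e
... | refl , e′ with ++-split A B C D e′ A≤C
...   | E , refl , B≡ED = E , refl , B≡ED

shorter-suffix⇒longer-prefix : ∀ {a s b s′ : Word} → a ++ s ≡ b ++ s′ → length s ≤ length s′ →
                               length b ≤ length a
shorter-suffix⇒longer-prefix {a} {s} {b} {s′} e s≤s′ =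
  ℕ.+-cancelʳ-≤ (length s) (length b) (length a) (begin
    length b + length s   ≤⟨ ℕ.+-monoʳ-≤ (length b) s≤s′ ⟩
    length b + length s′  ≡⟨ length-++ b ⟨
    length (b ++ s′)      ≡⟨ cong length e ⟨
    length (a ++ s)       ≡⟨ length-++ a ⟩
    length a + length s   ∎)
  where open ℕ.≤-Reasoning

suffix-of-suffix : ∀ {a b : Word} s s′ → a ++ s ≡ b ++ s′ → length s ≤ length s′ → Suffix s s′
suffix-of-suffix {a} {b} s s′ e s≤s′
  with ++-split b s′ a s (sym e) (shorter-suffix⇒longer-prefix {a} {s} {b} {s′} e s≤s′)
... | E , _ , s′≡Es = E , sym s′≡Es

suffix-length-injective : ∀ {a s b s′ : Word} → a ++ s ≡ b ++ s′ → length s ≡ length s′ → s ≡ s′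
suffix-length-injective {s = s} {s′ = s′} e same with suffix-of-suffix s s′ e (ℕ.≤-reflexive same)
... | []    , refl = refl
... | _ ∷ c , refl = ⊥-elim (ℕ.<-irrefl same (s≤s (length-++-≤ʳ _ {c})))

suffix-of-length : ∀ k (z : Word) → k ≤ length z → ∃ λ v → ∃ λ s → v ++ s ≡ z × length s ≡ k
suffix-of-length k z k≤z =
  take m z , drop m z , take++drop≡id m z , trans (length-drop m z) (ℕ.m∸[m∸n]≡n k≤z)
  where
  m : ℕ
  m = length z ∸ k

suffix⇒∈tails : ∀ {r} w → Suffix r w → r ∈ tails w
suffix⇒∈tails w       ([]    , refl) = here refl
suffix⇒∈tails (_ ∷ w) (_ ∷ t , e)    = there (suffix⇒∈tails w (t , ∷-injectiveʳ e))

∈tails⇒suffix : ∀ {r} w → r ∈ tails w → Suffix r w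
∈tails⇒suffix w       (here refl) = [] , refl
∈tails⇒suffix (x ∷ w) (there r∈)  with ∈tails⇒suffix w r∈
... | t , e = x ∷ t , cong (x ∷_) e

prefix∈inits : ∀ (u s : Word) → u ∈ inits (u ++ s)
prefix∈inits []      s = here refl
prefix∈inits (x ∷ u) s = there (∈-map⁺ (x ∷_) (prefix∈inits u s))

suffix⇒factor : ∀ {f w} → Suffix f w → Factor f w
suffix⇒factor {f} (t , e) = t , [] , trans (cong (t ++_) (++-identityʳ f)) e

factor-++ʳ : ∀ {f w} E → Factor f w → Factor f (w ++ E)
factor-++ʳ {f} E (p , s , e) = p , s ++ E , (begin
  p ++ f ++ s ++ E    ≡⟨ cong (p ++_) (++-assoc f s E) ⟨
  p ++ (f ++ s) ++ E  ≡⟨ ++-assoc p (f ++ s) E ⟨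
  (p ++ f ++ s) ++ E  ≡⟨ cong (_++ E) e ⟩
  _                   ∎)
  where open ≡-Reasoning

factor-++ˡ : ∀ {f w} E → Factor f w → Factor f (E ++ w)
factor-++ˡ {f} E (p , s , e) = E ++ p , s , trans (++-assoc E p (f ++ s)) (cong (E ++_) e)

factor-of-longer-prefix : ∀ {f A B C D} → Factor f A → A ++ B ≡ C ++ D → length A ≤ length C →
                          Factor f C
factor-of-longer-prefix {f} {A} {B} {C} {D} occ e A≤C with ++-split A B C D e A≤C
... | E , C≡AE , _ = subst (Factor f) (sym C≡AE) (factor-++ʳ E occ)

factor-of-init : ∀ {f a : Word} {y} q s → q ++ f ++ s ≡ a ∷ʳ y → 0 < length s → Factor f a
factor-of-init q s e 0<s with initLast s
factor-of-init q _ e () | []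
factor-of-init {f} {a} {y} q _ e _ | s′ ∷ʳ′ z =
  q , s′ , ∷ʳ-injectiveˡ (q ++ f ++ s′) a (begin
    (q ++ f ++ s′) ∷ʳ z   ≡⟨ ++-assoc q (f ++ s′) [ z ] ⟩
    q ++ ((f ++ s′) ∷ʳ z) ≡⟨ cong (q ++_) (++-assoc f s′ [ z ]) ⟩
    q ++ f ++ (s′ ∷ʳ z)   ≡⟨ e ⟩
    a ∷ʳ y                ∎)
  where open ≡-Reasoning

factor-snoc : ∀ {f a y} → Factor f (a ∷ʳ y) → Factor f a ⊎ Suffix f (a ∷ʳ y)
factor-snoc {f} (q , []        , e) = inj₂ (q , trans (cong (q ++_) (sym (++-identityʳ f))) e)
factor-snoc     (q , s@(_ ∷ _) , e) = inj₁ (factor-of-init q s e z<s)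

letter⇒factor : ∀ {z w} → z ∈ w → Factor [ z ] w
letter⇒factor {w = _ ∷ w} (here refl) = [] , w , refl
letter⇒factor {w = y ∷ _} (there z∈w) with letter⇒factor z∈w
... | p , s , e = y ∷ p , s , cong (y ∷_) e

factor⇒letter : ∀ {z w} → Factor [ z ] w → z ∈ w
factor⇒letter (p , s , e) = subst (_ ∈_) e (∈-++⁺ʳ p (here refl))

letter-of-extension : ∀ {w u : Word} {z} → All (_∈ w) u → z ∈ w ++ u → z ∈ w
letter-of-extension {w} {u} u⊆w z∈wu with ∈-++⁻ w {u} z∈wu
... | inj₁ z∈w = z∈w
... | inj₂ z∈u = All.lookup u⊆w z∈u

Unique-++⁻ʳ : ∀ (p : Word) {r} → Unique (p ++ r) → Unique r
Unique-++⁻ʳ []      u       = u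
Unique-++⁻ʳ (_ ∷ p) (_ ∷ u) = Unique-++⁻ʳ p u

palindrome? : (u : Word) → Dec (Palindrome u)
palindrome? u = ≡-dec _≟_ (reverse u) u

prefix? : (u w : Word) → Dec (Prefix u w)
prefix? []      w       = yes (w , refl)
prefix? (_ ∷ _) []      = no λ { (_ , ()) }
prefix? (x ∷ u) (y ∷ w) with x ≟ y | prefix? u w
... | yes refl | yes (s , e) = yes (s , cong (x ∷_) e)
... | yes refl | no ¬p       = no λ { (s , e) → ¬p (s , ∷-injectiveʳ e) }
... | no x≢y   | _           = no λ { (_ , e) → x≢y (∷-injectiveˡ e) }

factor? : (u w : Word) → Dec (Factor u w)
factor? u w with prefix? u w
... | yes (s , e) = yes ([] , s , e)
factor? u []      | no ¬p = no λ { ([] , s , e) → ¬p (s , e) ; (_ ∷ _ , _ , ()) }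
factor? u (y ∷ w) | no ¬p with factor? u w
... | yes (p , s , e) = yes (y ∷ p , s , cong (y ∷_) e)
... | no ¬f = no λ { ([] , s , e) → ¬p (s , e) ; (_ ∷ p , s , e) → ¬f (p , s , ∷-injectiveʳ e) }

palindrome-split : ∀ {t S T : Word} → t ++ S ≡ T → Palindrome T → T ≡ reverse S ++ reverse t
palindrome-split {t} {S} {T} e pal-T = begin
  T                      ≡⟨ pal-T ⟨
  reverse T              ≡⟨ cong reverse e ⟨
  reverse (t ++ S)       ≡⟨ reverse-++ t S ⟩
  reverse S ++ reverse t ∎
  where open ≡-Reasoning

palindromic-suffix⇒prefix : ∀ {t S T : Word} → t ++ S ≡ T → Palindrome S → Palindrome T →
                            T ≡ S ++ reverse t
palindromic-suffix⇒prefix {t} {S} {T} e pal-S pal-T =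
  trans (palindrome-split {t} {S} {T} e pal-T) (cong (_++ reverse t) pal-S)

palindrome-reflects-suffix : ∀ {t c π P : Word} → t ++ c ++ π ≡ P → Palindrome (c ++ π) →
                             (t ++ reverse π) ++ reverse c ≡ P
palindrome-reflects-suffix {t} {c} {π} {P} e pal = begin
  (t ++ reverse π) ++ reverse c ≡⟨ ++-assoc t (reverse π) (reverse c) ⟩
  t ++ reverse π ++ reverse c   ≡⟨ cong (t ++_) (palindrome-split {c} {π} refl pal) ⟨
  t ++ c ++ π                   ≡⟨ e ⟩
  P                             ∎
  where open ≡-Reasoning

palindrome-head∈tail : ∀ i xs → xs ≢ [] → Palindrome (i ∷ xs) → i ∈ xs
palindrome-head∈tail i xs xs≢[] pal with initLast xs
... | []       = ⊥-elim (xs≢[] refl)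
... | ys ∷ʳ′ z = subst (_∈ ys ∷ʳ z) z≡i (∈-++⁺ʳ ys (here refl))
  where
  z≡i : z ≡ i
  z≡i = ∷-injectiveˡ (begin
    z ∷ (reverse ys ∷ʳ i)    ≡⟨ cong (_∷ʳ i) (reverse-++ ys [ z ]) ⟨
    reverse (ys ∷ʳ z) ∷ʳ i   ≡⟨ unfold-reverse i (ys ∷ʳ z) ⟨
    reverse (i ∷ (ys ∷ʳ z))  ≡⟨ pal ⟩
    i ∷ (ys ∷ʳ z)            ∎)
    where open ≡-Reasoning

shorter-palindromic-suffix-occurs : ∀ {a y f S} → Suffix f (a ∷ʳ y) → Suffix S (a ∷ʳ y) →
  Palindrome f → Palindrome S → length f < length S → Factor f a
shorter-palindromic-suffix-occurs {a} {y} {f} {S} (_ , e₁) (t , e₂) pal-f pal-S f<S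
  with suffix-of-suffix f S (trans e₁ (sym e₂)) (ℕ.<⇒≤ f<S)
... | []        , refl = ⊥-elim (ℕ.<-irrefl refl f<S)
... | x ∷ c , refl = factor-of-init t (reverse (x ∷ c)) f-prefix (nonempty-reverse x c)
  where
  f-prefix : t ++ f ++ reverse (x ∷ c) ≡ a ∷ʳ y
  f-prefix = trans (cong (t ++_) (sym (palindromic-suffix⇒prefix refl pal-f pal-S))) e₂

new-palindromic-suffix-unique : ∀ {a y f S} → Suffix f (a ∷ʳ y) → Suffix S (a ∷ʳ y) →
  Palindrome f → Palindrome S → ¬ Factor f a → ¬ Factor S a → f ≡ S
new-palindromic-suffix-unique {f = f} {S} f⊒ S⊒ pal-f pal-S f∉a S∉a
  with ℕ.<-cmp (length f) (length S)
... | tri< f<S _ _ = ⊥-elim (f∉a (shorter-palindromic-suffix-occurs f⊒ S⊒ pal-f pal-S f<S))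
... | tri≈ _ f≡S _ = suffix-length-injective (trans (proj₂ f⊒) (sym (proj₂ S⊒))) f≡S
... | tri> _ _ S<f = ⊥-elim (S∉a (shorter-palindromic-suffix-occurs S⊒ f⊒ pal-S pal-f S<f))

new-palindromic-suffix? : ∀ a y →
  (∃ λ S → Suffix S (a ∷ʳ y) × Palindrome S × ¬ Factor S a) ⊎
  (∀ {f} → Suffix f (a ∷ʳ y) → Palindrome f → Factor f a)
new-palindromic-suffix? a y with any? (λ f → palindrome? f ×-dec ¬? (factor? f a)) (tails (a ∷ʳ y))
... | yes new with find new
...   | S , S∈ , pal , S∉a = inj₁ (S , ∈tails⇒suffix _ S∈ , pal , S∉a)
new-palindromic-suffix? a y | no none = inj₂ old
  where
  old : ∀ {f} → Suffix f (a ∷ʳ y) → Palindrome f → Factor f a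
  old {f} f⊒ pal with factor? f a
  ... | yes f∈a = f∈a
  ... | no f∉a = ⊥-elim (none (lose (suffix⇒∈tails _ f⊒) (pal , f∉a)))

-- Counting palindromic factors

PalindromeCover : List Word → Word → Set
PalindromeCover M w = ∀ {f} → Factor f w → Palindrome f → f ∈ M

cover-[] : PalindromeCover [ [] ] []
cover-[] {[]}    _                _ = here refl
cover-[] {_ ∷ _} ([]    , _ , ()) _
cover-[] {_ ∷ _} (_ ∷ _ , _ , ()) _

cover-snoc-old : ∀ {M a y} → PalindromeCover M a →
  (∀ {f} → Suffix f (a ∷ʳ y) → Palindrome f → Factor f a) → PalindromeCover M (a ∷ʳ y)
cover-snoc-old cover old occ pal with factor-snoc occ
... | inj₁ f∈a = cover f∈a pal
... | inj₂ f⊒  = cover (old f⊒ pal) pal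

cover-snoc-new : ∀ {M a y S} → PalindromeCover M a → Suffix S (a ∷ʳ y) → Palindrome S →
  ¬ Factor S a → PalindromeCover (S ∷ M) (a ∷ʳ y)
cover-snoc-new {a = a} cover S⊒ pal-S S∉a {f} occ pal with factor? f a
... | yes f∈a = there (cover f∈a pal)
... | no f∉a with factor-snoc occ
...   | inj₁ f∈a = ⊥-elim (f∉a f∈a)
...   | inj₂ f⊒  = here (new-palindromic-suffix-unique f⊒ S⊒ pal pal-S f∉a S∉a)

cover-snoc : ∀ {M a} y → PalindromeCover M a →
  ∃ λ M′ → PalindromeCover M′ (a ∷ʳ y) × length M′ ≤ suc (length M)
cover-snoc {M} {a} y cover with new-palindromic-suffix? a y
... | inj₁ (S , S⊒ , pal , S∉a) = S ∷ M , cover-snoc-new cover S⊒ pal S∉a , ℕ.≤-refl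
... | inj₂ old                  = M , cover-snoc-old cover old , ℕ.n≤1+n _

cover-++ : ∀ {M a} s → PalindromeCover M a →
  ∃ λ M′ → PalindromeCover M′ (a ++ s) × length M′ ≤ length M + length s
cover-++ {M} {a} [] cover =
  M , subst (PalindromeCover M) (sym (++-identityʳ a)) cover , ℕ.m≤m+n (length M) 0
cover-++ {M} {a} (y ∷ s) cover with cover-snoc y cover
... | M₁ , cover₁ , M₁≤ with cover-++ s cover₁
...   | M′ , cover′ , M′≤ = M′ , subst (PalindromeCover M′) (∷ʳ-++ a y s) cover′ , (begin
        length M′                 ≤⟨ M′≤ ⟩
        length M₁ + length s      ≤⟨ ℕ.+-monoˡ-≤ (length s) M₁≤ ⟩
        suc (length M) + length s ≡⟨ ℕ.+-suc (length M) (length s) ⟨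
        length M + suc (length s) ∎)
  where open ℕ.≤-Reasoning

-- The Droubay–Justin–Pirillo bound: each letter adds at most one new palindromic factor.
palindrome-cover : ∀ w → ∃ λ M → PalindromeCover M w × length M ≤ suc (length w)
palindrome-cover w = cover-++ w cover-[]

∈-─ : ∀ {A : Set} {x z : A} {M} (x∈M : x ∈ M) → z ∈ M → z ≢ x → z ∈ M ─ x∈M
∈-─ (here refl) (here refl)  z≢x = ⊥-elim (z≢x refl)
∈-─ (here refl) (there z∈M)  _   = z∈M
∈-─ (there _)   (here refl)  _   = here refl
∈-─ (there x∈M) (there z∈M)  z≢x = there (∈-─ x∈M z∈M z≢x)

unique-⊆⇒length-≤ : ∀ {A : Set} {L M : List A} → Unique L → L ⊆ M → length L ≤ length M
unique-⊆⇒length-≤ {L = []}    _              _   = z≤n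
unique-⊆⇒length-≤ {L = x ∷ L} {M} (x∉L ∷ uniq) L⊆M = begin
  suc (length L)         ≤⟨ s≤s (unique-⊆⇒length-≤ uniq L⊆M─x) ⟩
  suc (length (M ─ x∈M)) ≡⟨ length-removeAt′ M (index x∈M) ⟨
  length M               ∎
  where
  open ℕ.≤-Reasoning
  x∈M : x ∈ M
  x∈M = L⊆M (here refl)
  L⊆M─x : L ⊆ M ─ x∈M
  L⊆M─x z∈L = ∈-─ x∈M (L⊆M (there z∈L)) (λ z≡x → All.lookup x∉L z∈L (sym z≡x))

rich-cover-length : ∀ {w M} → Rich w → PalindromeCover M w → suc (length w) ≤ length M
rich-cover-length {M = M} (L , uniq , L⇔ , |L|) cover =
  subst (_≤ length M) |L| (unique-⊆⇒length-≤ uniq L⊆M)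
  where
  L⊆M : L ⊆ M
  L⊆M {f} f∈L with Equivalence.to (L⇔ f) f∈L
  ... | occ , pal = cover occ pal

-- Otherwise the palindromic factors of v x are those of v, and the cover bound leaves room
-- for at most |v x s| palindromic factors.
rich⇒new-palindromic-suffix : ∀ {v x s} → Rich ((v ∷ʳ x) ++ s) →
  ∃ λ f → Suffix f (v ∷ʳ x) × Palindrome f × ¬ Factor f v
rich⇒new-palindromic-suffix {v} {x} {s} rich with new-palindromic-suffix? v x
... | inj₁ new = new
... | inj₂ old with palindrome-cover v
...   | Mv , cover-v , Mv≤ with cover-++ s (cover-snoc-old {y = x} cover-v old)
...     | M , cover , M≤ = ⊥-elim (ℕ.n≮n _ (begin-strict
          length ((v ∷ʳ x) ++ s)     <⟨ rich-cover-length rich cover ⟩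
          length M                   ≤⟨ M≤ ⟩
          length Mv + length s       ≤⟨ ℕ.+-monoˡ-≤ (length s) Mv≤ ⟩
          suc (length v) + length s  ≡⟨ cong (_+ length s) (length-∷ʳ v x) ⟨
          length (v ∷ʳ x) + length s ≡⟨ length-++ (v ∷ʳ x) ⟨
          length ((v ∷ʳ x) ++ s)     ∎))
  where open ℕ.≤-Reasoning

rich-by-enumeration : ∀ {w} (L : List Word) → Unique L → All (λ u → Factor u w × Palindrome u) L →
  All (λ t → All (λ u → Palindrome u → u ∈ L) (inits t)) (tails w) → length L ≡ suc (length w) →
  Rich w
rich-by-enumeration {w} L uniq sound complete |L| =
  L , uniq , (λ u → mk⇔ (All.lookup sound) (from u)) , |L|
  where
  from : ∀ u → Factor u w × Palindrome u → u ∈ L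
  from u ((p , s , e) , pal) =
    All.lookup (All.lookup complete (suffix⇒∈tails w (p , e))) (prefix∈inits u s) pal

distinct-letters⇒rich : ∀ {w} → Unique w → Rich w
distinct-letters⇒rich {w} uniq =
  [] ∷ map [_] w , uniq-L , (λ u → mk⇔ (sound u) (complete u)) , cong suc (length-map [_] w)
  where
  uniq-L : Unique ([] ∷ map [_] w)
  uniq-L = AllProp.map⁺ (All.tabulate λ _ ()) ∷ Unique.map⁺ ∷-injectiveˡ uniq
  sound : ∀ u → u ∈ [] ∷ map [_] w → Factor u w × Palindrome u
  sound _ (here refl) = ([] , w , refl) , refl
  sound u (there u∈) with ∈-map⁻ [_] u∈
  ... | _ , i∈w , refl = letter⇒factor i∈w , refl
  complete : ∀ u → Factor u w × Palindrome u → u ∈ [] ∷ map [_] w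
  complete []               _                     = here refl
  complete (_ ∷ [])         (occ , _)             = there (∈-map⁺ [_] (factor⇒letter occ))
  complete (i ∷ xs@(_ ∷ _)) ((p , s , e) , pal) =
    ⊥-elim (Unique.Unique[x∷xs]⇒x∉xs (Unique-++⁻ʳ p (subst Unique (sym e) uniq))
                                      (∈-++⁺ˡ (palindrome-head∈tail i xs (λ ()) pal)))

distinct-letters⇒alphSize : ∀ {w} → Unique w → AlphSize w (length w)
distinct-letters⇒alphSize {w} uniq = w , uniq , (λ _ → mk⇔ id id) , refl

-- Forbidden factors

module ForbiddenFactors
  (w : Word) (Forbidden : Word → Set)
  (reverse-closed : ∀ {π} → Forbidden π → Forbidden (reverse π))
  (palindromic-suffixes-occur : ∀ {π} → Forbidden π → All (_∈ w) π →
                                ∀ {r} → Suffix r π → Palindrome r → Factor r w)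
  (absent : ∀ {π} → Forbidden π → ¬ Factor π w)
  where

  module _ {u : Word} (u⊆w : All (_∈ w) u) (rich : Rich (w ++ u)) where

    NoForbiddenSuffixBelow : ℕ → Set
    NoForbiddenSuffixBelow n =
      ∀ {P C π} → P ++ C ≡ w ++ u → length P < n → Forbidden π → ¬ Suffix π P

    letters-in-w : ∀ {P C π} → P ++ C ≡ w ++ u → Suffix π P → All (_∈ w) π
    letters-in-w {P} {C} e (t , tπ≡P) = All.tabulate λ {z} z∈π →
      letter-of-extension u⊆w (subst (z ∈_) e (∈-++⁺ˡ {ys = C} (subst (z ∈_) tπ≡P (∈-++⁺ʳ t z∈π))))

    forbidden-suffix-beyond-w : ∀ {n v x C π} → NoForbiddenSuffixBelow n → (v ∷ʳ x) ++ C ≡ w ++ u →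
      length (v ∷ʳ x) ≤ n → length w ≤ length v → Forbidden π → ¬ Suffix π (v ∷ʳ x)
    forbidden-suffix-beyond-w {n} {v} {x} {C} {π} earlier e P≤n w≤v fπ π⊒P@(_ , tπ≡P)
      with rich⇒new-palindromic-suffix {s = C} (subst Rich (sym e) rich)
    ... | f , (tf , tf≡P) , pal-f , f∉v with length f ≤? length π
    ...   | yes f≤π = f∉v (factor-of-longer-prefix
                              (palindromic-suffixes-occur fπ (letters-in-w e π⊒P)
                                (suffix-of-suffix f π (trans tf≡P (sym tπ≡P)) f≤π) pal-f)
                              (trans (sym e) (∷ʳ-++ v x C)) w≤v)
    ...   | no f≰π with suffix-of-suffix π f (trans tπ≡P (sym tf≡P)) (ℕ.<⇒≤ (ℕ.≰⇒> f≰π))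
    ...     | []        , refl = f≰π ℕ.≤-refl
    ...     | y ∷ c , refl =
              earlier occurrence (ℕ.<-≤-trans shorter P≤n) (reverse-closed fπ) (tf , refl)
      where
      reflected : (tf ++ reverse π) ++ reverse (y ∷ c) ≡ v ∷ʳ x
      reflected = palindrome-reflects-suffix {tf} {y ∷ c} {π} tf≡P pal-f
      occurrence : (tf ++ reverse π) ++ reverse (y ∷ c) ++ C ≡ w ++ u
      occurrence = trans (sym (++-assoc (tf ++ reverse π) (reverse (y ∷ c)) C))
                         (trans (cong (_++ C) reflected) e)
      shorter : length (tf ++ reverse π) < length (v ∷ʳ x)
      shorter = proper-prefix-shorter {tf ++ reverse π} {reverse (y ∷ c)} reflected (nonempty-reverse y c)

    no-forbidden-suffix : ∀ n → NoForbiddenSuffixBelow n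
    no-forbidden-suffix zero    _ ()
    no-forbidden-suffix (suc n) {P} e (s≤s P≤n) fπ π⊒P with length P ≤? length w
    ... | yes P≤w = absent fπ (factor-of-longer-prefix (suffix⇒factor π⊒P) e P≤w)
    ... | no P≰w with initLast P
    ...   | []       = P≰w z≤n
    ...   | v ∷ʳ′ x = forbidden-suffix-beyond-w (no-forbidden-suffix n) e P≤n w≤v fπ π⊒P
      where
      w≤v : length w ≤ length v
      w≤v = ℕ.≤-pred (subst (length w <_) (length-∷ʳ v x) (ℕ.≰⇒> P≰w))

    forbidden-absent : ∀ {π} → Forbidden π → ¬ Factor π (w ++ u)
    forbidden-absent {π} fπ (A , C , e) =
      no-forbidden-suffix (suc (length (A ++ π))) (trans (++-assoc A π C) e) ℕ.≤-refl fπ (A , refl)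

  not-eventually-extendable : ∀ k → k ≤ length w →
    (∀ s → length s ≡ k → All (_∈ w) s → ∃ λ a → a ∈ w × ∃ λ π → Forbidden π × Factor π (s ∷ʳ a)) →
    ¬ EventuallyFullyExtendable w
  not-eventually-extendable k k≤w completion (u , u⊆w , _ , rich-ext)
    with suffix-of-length k (w ++ u) (ℕ.≤-trans k≤w (length-++-≤ˡ w))
  ... | v , s , vs≡wu , |s|≡k
      with completion s |s|≡k
             (All.tabulate λ {z} z∈s → letter-of-extension u⊆w (subst (z ∈_) vs≡wu (∈-++⁺ʳ v z∈s)))
  ...   | a , a∈w , π , fπ , occ =
          forbidden-absent (AllProp.∷ʳ⁺ u⊆w a∈w) (rich-ext a a∈w) fπ
                           (subst (Factor π) completed (factor-++ˡ v occ))
    where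
    open ≡-Reasoning
    completed : v ++ (s ∷ʳ a) ≡ w ++ (u ∷ʳ a)
    completed = begin
      v ++ (s ∷ʳ a)   ≡⟨ ++-assoc v s [ a ] ⟨
      (v ++ s) ∷ʳ a   ≡⟨ cong (_∷ʳ a) vs≡wu ⟩
      (w ++ u) ∷ʳ a   ≡⟨ ++-assoc w u [ a ] ⟩
      w ++ (u ∷ʳ a)   ∎

-- n ≥ 4: the word 0 1 … n-1

Distant : ℕ → ℕ → Set
Distant i j = 2 + i ≤ j ⊎ 2 + j ≤ i

Jump : Word → Set
Jump (i ∷ j ∷ []) = Distant i j
Jump _            = ⊥

¬2+n≤n : ∀ n → ¬ 2 + n ≤ n
¬2+n≤n n 2+n≤n = ℕ.n≮n n (ℕ.≤-trans (ℕ.n≤1+n (suc n)) 2+n≤n)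

distant-irrefl : ∀ {i} → ¬ Distant i i
distant-irrefl {i} (inj₁ d) = ¬2+n≤n i d
distant-irrefl {i} (inj₂ d) = ¬2+n≤n i d

¬distant-suc : ∀ {i} → ¬ Distant i (suc i)
¬distant-suc {i} (inj₁ d) = ℕ.n≮n (suc i) d
¬distant-suc {i} (inj₂ d) = ¬2+n≤n i (ℕ.≤-trans (ℕ.n≤1+n _) d)

applyUpTo-consecutive : ∀ {A : Set} (f : ℕ → A) n (P : List A) {i j C} →
  P ++ i ∷ j ∷ C ≡ applyUpTo f n → ∃ λ k → i ≡ f k × j ≡ f (suc k)
applyUpTo-consecutive f zero          []      ()
applyUpTo-consecutive f zero          (_ ∷ _) ()
applyUpTo-consecutive f (suc zero)    []      ()
applyUpTo-consecutive f (suc (suc n)) []      refl = 0 , refl , refl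
applyUpTo-consecutive f (suc n)       (_ ∷ P) e
  with applyUpTo-consecutive (λ k → f (suc k)) n P (∷-injectiveʳ e)
... | k , i≡ , j≡ = suc k , i≡ , j≡

jump-reverse : ∀ {π} → Jump π → Jump (reverse π)
jump-reverse {_ ∷ _ ∷ []} = swap

jump-palindromic-suffixes : ∀ {w π} → Jump π → All (_∈ w) π →
  ∀ {r} → Suffix r π → Palindrome r → Factor r w
jump-palindromic-suffixes {π = i ∷ j ∷ []} d _ ([] , refl) pal =
  ⊥-elim (distant-irrefl (subst (Distant i) (∷-injectiveˡ pal) d))
jump-palindromic-suffixes {π = _ ∷ _ ∷ []} _ (_ ∷ j∈w ∷ []) (_ ∷ [] , refl) _ = letter⇒factor j∈w
jump-palindromic-suffixes {w} {_ ∷ _ ∷ []} _ _ (_ ∷ _ ∷ [] , refl) _ = [] , w , refl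

jump-absent : ∀ {n π} → Jump π → ¬ Factor π (upTo n)
jump-absent {n} {_ ∷ _ ∷ []} d (A , _ , e) with applyUpTo-consecutive id n A e
... | _ , refl , refl = ¬distant-suc d

upTo-completion : ∀ {n} → 4 ≤ n → ∀ s → length s ≡ 1 → All (_∈ upTo n) s →
  ∃ λ a → a ∈ upTo n × ∃ λ π → Jump π × Factor π (s ∷ʳ a)
upTo-completion 4≤n (ℓ ∷ []) refl _ with ℓ ≤? 1
... | yes ℓ≤1 = 3 , ∈-upTo⁺ 4≤n , ℓ ∷ 3 ∷ [] , inj₁ (s≤s (s≤s ℓ≤1)) , [] , [] , refl
... | no ℓ≰1  = 0 , ∈-upTo⁺ (ℕ.≤-trans z<s 4≤n) , ℓ ∷ 0 ∷ [] , inj₂ (ℕ.≰⇒> ℓ≰1) , [] , [] , refl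

upTo-not-eventually-extendable : ∀ n → 4 ≤ n → ¬ EventuallyFullyExtendable (upTo n)
upTo-not-eventually-extendable n 4≤n =
  not-eventually-extendable 1 (subst (1 ≤_) (sym (length-upTo n)) (ℕ.≤-trans z<s 4≤n))
                            (upTo-completion 4≤n)
  where open ForbiddenFactors (upTo n) Jump jump-reverse jump-palindromic-suffixes jump-absent

-- n = 3: the word 00101102

module Words = DecMembership (≡-dec _≟_)
module Letters = DecMembership _≟_

w₃ : Word
w₃ = 0 ∷ 0 ∷ 1 ∷ 0 ∷ 1 ∷ 1 ∷ 0 ∷ 2 ∷ []

A₃ : List ℕ
A₃ = 0 ∷ 1 ∷ 2 ∷ []

palindromes-w₃ : List Word
palindromes-w₃ = [] ∷ (0 ∷ []) ∷ (0 ∷ 0 ∷ []) ∷ (1 ∷ []) ∷ (0 ∷ 1 ∷ 0 ∷ []) ∷ (1 ∷ 0 ∷ 1 ∷ []) ∷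
                 (1 ∷ 1 ∷ []) ∷ (0 ∷ 1 ∷ 1 ∷ 0 ∷ []) ∷ (2 ∷ []) ∷ []

B₃ : List Word
B₃ = (1 ∷ 2 ∷ []) ∷ (2 ∷ 1 ∷ []) ∷ (0 ∷ 0 ∷ 2 ∷ []) ∷ (2 ∷ 0 ∷ 0 ∷ []) ∷
     (0 ∷ 1 ∷ 0 ∷ 2 ∷ []) ∷ (2 ∷ 0 ∷ 1 ∷ 0 ∷ []) ∷ (0 ∷ 0 ∷ 1 ∷ 1 ∷ []) ∷ (1 ∷ 1 ∷ 0 ∷ 0 ∷ []) ∷ []

w₃-rich : Rich w₃
w₃-rich = rich-by-enumeration palindromes-w₃
  (toWitness {a? = allPairs? (λ x y → ¬? (≡-dec _≟_ x y)) palindromes-w₃} tt)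
  (toWitness {a? = all? (λ u → factor? u w₃ ×-dec palindrome? u) palindromes-w₃} tt)
  (toWitness {a? = all? (λ t → all? (λ u → palindrome? u →-dec (u Words.∈? palindromes-w₃)) (inits t))
                        (tails w₃)} tt)
  refl

-- abstract: these certificates matter only through their types, and unfolding their
-- normal forms later exhausts memory.
abstract
  A₃⊆w₃ : All (_∈ w₃) A₃
  A₃⊆w₃ = toWitness {a? = all? (Letters._∈? w₃) A₃} tt

  w₃⊆A₃ : All (_∈ A₃) w₃
  w₃⊆A₃ = toWitness {a? = all? (Letters._∈? A₃) w₃} tt

  B₃-reverse-closed : All (λ π → reverse π ∈ B₃) B₃
  B₃-reverse-closed = toWitness {a? = all? (λ π → reverse π Words.∈? B₃) B₃} tt

  B₃-palindromic-suffixes : All (λ π → All (λ r → Palindrome r → Factor r w₃) (tails π)) B₃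
  B₃-palindromic-suffixes =
    toWitness {a? = all? (λ π → all? (λ r → palindrome? r →-dec factor? r w₃) (tails π)) B₃} tt

  B₃-absent : All (λ π → ¬ Factor π w₃) B₃
  B₃-absent = toWitness {a? = all? (λ π → ¬? (factor? π w₃)) B₃} tt

  B₃-completions : All (λ x → All (λ y → All (λ z →
    Any (λ a → Any (λ π → Factor π (x ∷ y ∷ z ∷ a ∷ [])) B₃) w₃) A₃) A₃) A₃
  B₃-completions = toWitness {a? = all? (λ x → all? (λ y → all? (λ z →
    any? (λ a → any? (λ π → factor? π (x ∷ y ∷ z ∷ a ∷ [])) B₃) w₃) A₃) A₃) A₃} tt

w₃-alphSize : AlphSize w₃ 3
w₃-alphSize = A₃ , toWitness {a? = allPairs? (λ x y → ¬? (x ≟ y)) A₃} tt ,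
              (λ _ → mk⇔ (All.lookup A₃⊆w₃) (All.lookup w₃⊆A₃)) , refl

w₃-completion : ∀ s → length s ≡ 3 → All (_∈ w₃) s →
  ∃ λ a → a ∈ w₃ × ∃ λ π → π ∈ B₃ × Factor π (s ∷ʳ a)
w₃-completion (x ∷ y ∷ z ∷ []) refl (x∈ ∷ y∈ ∷ z∈ ∷ [])
  with find (All.lookup (All.lookup (All.lookup B₃-completions (All.lookup w₃⊆A₃ x∈))
                                    (All.lookup w₃⊆A₃ y∈))
                        (All.lookup w₃⊆A₃ z∈))
... | a , a∈w₃ , completes with find completes
...   | π , π∈B₃ , occ = a , a∈w₃ , π , π∈B₃ , occ

w₃-not-eventually-extendable : ¬ EventuallyFullyExtendable w₃
w₃-not-eventually-extendable = not-eventually-extendable 3 (s≤s (s≤s (s≤s z≤n))) w₃-completion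
  where
  open ForbiddenFactors w₃ (_∈ B₃) (All.lookup B₃-reverse-closed)
         (λ π∈B₃ _ r⊒π → All.lookup (All.lookup B₃-palindromic-suffixes π∈B₃) (suffix⇒∈tails _ r⊒π))
         (All.lookup B₃-absent)

mainTheorem4 : (n : ℕ) → 3 ≤ n →
    ∃ λ (w : Word) → Rich w × AlphSize w n ×
      ¬ (∃ λ (u : Word) → All (λ b → b ∈ w) u × Rich (w ++ u) ×
           (∀ (a : ℕ) → a ∈ w → Rich (w ++ u ++ a ∷ [])))
mainTheorem4 zero                ()
mainTheorem4 (suc zero)          (s≤s ())
mainTheorem4 (suc (suc zero))    (s≤s (s≤s ()))
mainTheorem4 (suc (suc (suc zero))) _ =
  w₃ , w₃-rich , w₃-alphSize , w₃-not-eventually-extendable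
mainTheorem4 n@(suc (suc (suc (suc _)))) _ =
  upTo n , distinct-letters⇒rich (Unique.upTo⁺ n) ,
  subst (AlphSize (upTo n)) (length-upTo n) (distinct-letters⇒alphSize (Unique.upTo⁺ n)) ,
  upTo-not-eventually-extendable n (s≤s (s≤s (s≤s (s≤s z≤n))))
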